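{- For every positive integer $n$, the number of right-to-left maxima and the number of right-to-left minima of $\sigma\in S_n$ are each $H_n$-mesic with respect to the Lehmer code rotation, where $H_n=\sum_{i=1}^n\frac1i$.
   Context: A statistic $f$ is $c$-mesic with respect to a bijection $\mathcal{X}$ of a finite set if its average over every orbit of $\mathcal{X}$ equals $c$. A right-to-left maximum (minimum) of $\sigma$ is an entry $\sigma_i$ with $\sigma_j<\sigma_i$ (resp. $\sigma_j>\sigma_i$) for all $j>i$. Lehmer code: $L(\sigma)_i=\#\{j>i:\sigma_j<\sigma_i\}\in\{0,\dots,n-i\}$, a bijection from $S_n$ to such tuples; the Lehmer code rotation sends $\sigma$ to the unique $\tau$ with $L(\tau)_i\equiv L(\sigma)_i+1\pmod{n-i+1}$ for all $i$. -}

module Defs where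

open import Data.Nat using (ℕ; zero; suc; _<?_; _%_)
open import Data.Integer using (+_)
open import Data.List using (List; []; _∷_; length; upTo; filter)
open import Data.List.Relation.Unary.All using (all?)
open import Data.List.Relation.Binary.Permutation.Propositional using (_↭_)
open import Data.Rational using (ℚ; _/_; 0ℚ; _+_)
open import Relation.Nullary using (yes; no)
import Relation.Binary.PropositionalEquality
import Data.Product
import Data.Nat

-- A permutation σ ∈ S_n in one-line notation, with values 0,…,n-1
-- (0-based values; the statistics below only depend on relative order).
IsPerm : ℕ → List ℕ → Set
IsPerm n σ = σ ↭ upTo n

lehmer : List ℕ → List ℕ
lehmer []       = []
lehmer (x ∷ xs) = length (filter (_<? x) xs) ∷ lehmer xs

-- Rotation of a Lehmer code: entry i (of a code of length n, 1-based i)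
-- is replaced by (L_i + 1) mod (n - i + 1); the number of entries after
-- position i is n - i, so the modulus is suc (length of the tail).
rotCode : List ℕ → List ℕ
rotCode []       = []
rotCode (c ∷ cs) = (suc c % suc (length cs)) ∷ rotCode cs

rlMax : List ℕ → ℕ
rlMax []       = 0
rlMax (x ∷ xs) with all? (_<? x) xs
... | yes _ = suc (rlMax xs)
... | no  _ = rlMax xs

rlMin : List ℕ → ℕ
rlMin []       = 0
rlMin (x ∷ xs) with all? (x <?_) xs
... | yes _ = suc (rlMin xs)
... | no  _ = rlMin xs

iter : {A : Set} → (A → A) → ℕ → A → A
iter f zero    x = x
iter f (suc k) x = f (iter f k x)

sumBelow : ℕ → (ℕ → ℕ) → ℕ
sumBelow zero    g = 0
sumBelow (suc k) g = sumBelow k g Data.Nat.+ g k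

harmonic : ℕ → ℚ
harmonic zero    = 0ℚ
harmonic (suc n) = harmonic n + (+ 1 / suc n)

OrbitAverageIs : (X : List ℕ → List ℕ) (f : List ℕ → ℕ) (c : ℚ) (σ : List ℕ) → Set
OrbitAverageIs X f c σ =
  (k : ℕ) → .{{_ : Data.Nat.NonZero k}} →
  iter X k σ Relation.Binary.PropositionalEquality.≡ σ →
  ((j : ℕ) → 0 Data.Nat.< j → j Data.Nat.< k → Relation.Nullary.¬ (iter X j σ Relation.Binary.PropositionalEquality.≡ σ)) →
  (+ sumBelow k (λ j → f (iter X j σ)) / k) Relation.Binary.PropositionalEquality.≡ c

Mesic : (n : ℕ) (X : List ℕ → List ℕ) (f : List ℕ → ℕ) (c : ℚ) → Set
Mesic n X f c = (σ : List ℕ) → IsPerm n σ → OrbitAverageIs X f c σ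

-- X is the Lehmer code rotation on S_n: it maps S_n into S_n and
-- L(X σ) is the rotated code of L(σ) (this determines X σ uniquely,
-- since the Lehmer code is injective on S_n).
IsLehmerRotation : (n : ℕ) (X : List ℕ → List ℕ) → Set
IsLehmerRotation n X = (σ : List ℕ) → IsPerm n σ →
  IsPerm n (X σ) Data.Product.× (lehmer (X σ) Relation.Binary.PropositionalEquality.≡ rotCode (lehmer σ))

-- A code entry followed by m entries lies in [0, m]; σ_i is a right-to-left maximum exactly
-- when L(σ)_i is maximal (= m) and, σ having distinct entries, a right-to-left minimum exactly
-- when L(σ)_i = 0.  The rotation acts on each entry independently as translation modulo m + 1,
-- so a period k of an orbit is a multiple of every d ≤ n, and along the orbit the entry with
-- modulus d takes each value below d exactly k/d times.  Both statistics therefore sum to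
-- Σ_{d ≤ n} k/d over the orbit, an average of H_n.
module Submission where

open import Defs
open import Data.Nat using (ℕ; suc)
open import Data.List using (List)
open import Data.Product using (_×_)

open import Data.Nat using (zero; _+_; _*_; _/_; _%_; _<_; _≤_; NonZero; s≤s; z<s)
open import Data.Nat.Properties
open import Data.Nat.DivMod using ([m+n]%n≡m%n; m≡m%n+[m/n]*n; %-distribˡ-+; m%n%n≡m%n; m<n⇒m%n≡m; m*n/n≡m; m/n*n≡m)
open import Data.Nat.Divisibility using (_∣_; divides)
open import Data.Nat.Tactic.RingSolver using (solve-∀)
import Data.Integer as ℤ
open import Data.Integer.Properties using (pos-+; pos-*)
import Data.Rational as ℚ
open import Data.Rational.Properties using (toℚᵘ-injective; toℚᵘ-homo-+; toℚᵘ-fromℚᵘ; 0/n≡0)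
open import Data.Rational.Unnormalised as ℚᵘ using (mkℚᵘ; *≡*)
open import Data.Rational.Unnormalised.Properties using (≃-sym; +-cong; module ≃-Reasoning)
open import Data.List using ([]; _∷_; length)
open import Data.List.Properties using (length-filter; filter-all; filter-none; filter-some; filter-notAll; length-upTo; ∷-injective)
open import Data.List.Relation.Unary.All as All using (All; _∷_; all?)
open import Data.List.Relation.Unary.All.Properties using (¬All⇒Any¬)
open import Data.List.Relation.Unary.Any using (Any; here; there)
open import Data.List.Relation.Unary.AllPairs using (_∷_)
open import Data.List.Relation.Unary.Unique.Propositional using (Unique)
open import Data.List.Relation.Unary.Unique.Propositional.Properties using (upTo⁺)
open import Data.List.Relation.Binary.Permutation.Propositional using (↭-sym; ↭⇒↭ₛ)
open import Data.List.Relation.Binary.Permutation.Propositional.Properties using (↭-length)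
open import Data.List.Relation.Binary.Permutation.Setoid.Properties using (Unique-resp-↭)
open import Data.Product using (_,_; proj₁; proj₂)
open import Data.Unit using (⊤; tt)
open import Data.Empty using (⊥-elim)
open import Relation.Nullary using (yes; no; ¬_)
open import Function using (_∘_)
open import Relation.Binary.PropositionalEquality

δ : ℕ → ℕ → ℕ
δ a b with a ≟ b
... | yes _ = 1
... | no  _ = 0

δ-refl : ∀ a → δ a a ≡ 1
δ-refl a with a ≟ a
... | yes _  = refl
... | no a≢a = ⊥-elim (a≢a refl)

δ-≢ : ∀ {a b} → a ≢ b → δ a b ≡ 0
δ-≢ {a} {b} a≢b with a ≟ b
... | yes a≡b = ⊥-elim (a≢b a≡b)
... | no  _   = refl

sumBelow-cong : ∀ k {f g : ℕ → ℕ} → (∀ j → j < k → f j ≡ g j) → sumBelow k f ≡ sumBelow k g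
sumBelow-cong zero    _   = refl
sumBelow-cong (suc k) f≗g = cong₂ _+_ (sumBelow-cong k (λ j j<k → f≗g j (m<n⇒m<1+n j<k))) (f≗g k (n<1+n k))

sumBelow-zero : ∀ k → sumBelow k (λ _ → 0) ≡ 0
sumBelow-zero zero    = refl
sumBelow-zero (suc k) = trans (+-identityʳ _) (sumBelow-zero k)

sumBelow-+ : ∀ k (f g : ℕ → ℕ) → sumBelow k (λ j → f j + g j) ≡ sumBelow k f + sumBelow k g
sumBelow-+ zero    f g = refl
sumBelow-+ (suc k) f g = begin
  sumBelow k (λ j → f j + g j) + (f k + g k)    ≡⟨ cong (_+ (f k + g k)) (sumBelow-+ k f g) ⟩
  (sumBelow k f + sumBelow k g) + (f k + g k)   ≡⟨ +-comm-middle (sumBelow k f) (sumBelow k g) (f k) (g k) ⟩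
  (sumBelow k f + f k) + (sumBelow k g + g k)   ∎
  where
  open ≡-Reasoning
  +-comm-middle : ∀ a b c d → (a + b) + (c + d) ≡ (a + c) + (b + d)
  +-comm-middle = solve-∀

sumBelow-split : ∀ a b (f : ℕ → ℕ) → sumBelow (a + b) f ≡ sumBelow a f + sumBelow b (λ j → f (a + j))
sumBelow-split a zero    f rewrite +-identityʳ a = sym (+-identityʳ _)
sumBelow-split a (suc b) f rewrite +-suc a b | sumBelow-split a b f =
  +-assoc (sumBelow a f) (sumBelow b (λ j → f (a + j))) (f (a + b))

sumBelow-suc : ∀ d (h : ℕ → ℕ) → sumBelow (suc d) h ≡ h 0 + sumBelow d (λ j → h (suc j))
sumBelow-suc zero    h = sym (+-identityʳ (h 0))
sumBelow-suc (suc d) h rewrite sumBelow-suc d h = +-assoc (h 0) _ _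

sumBelow-rotate : ∀ d (h : ℕ → ℕ) → h d ≡ h 0 → sumBelow d (λ j → h (suc j)) ≡ sumBelow d h
sumBelow-rotate d h hd≡h0 = +-cancelˡ-≡ (h 0) _ _ (begin
  h 0 + sumBelow d (λ j → h (suc j))   ≡⟨ sumBelow-suc d h ⟨
  sumBelow d h + h d                   ≡⟨ cong (sumBelow d h +_) hd≡h0 ⟩
  sumBelow d h + h 0                   ≡⟨ +-comm (sumBelow d h) (h 0) ⟩
  h 0 + sumBelow d h                   ∎)
  where open ≡-Reasoning

module _ {d : ℕ} (f : ℕ → ℕ) (f-periodic : ∀ x → f (x + d) ≡ f x) where

  sumBelow-periodic-shift : ∀ c → sumBelow d (λ j → f (c + j)) ≡ sumBelow d f
  sumBelow-periodic-shift zero    = refl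
  sumBelow-periodic-shift (suc c) = begin
    sumBelow d (λ j → f (suc c + j))   ≡⟨ sumBelow-cong d (λ j _ → cong f (sym (+-suc c j))) ⟩
    sumBelow d (λ j → f (c + suc j))   ≡⟨ sumBelow-rotate d (λ j → f (c + j)) fcd≡fc0 ⟩
    sumBelow d (λ j → f (c + j))       ≡⟨ sumBelow-periodic-shift c ⟩
    sumBelow d f                       ∎
    where
    open ≡-Reasoning
    fcd≡fc0 : f (c + d) ≡ f (c + 0)
    fcd≡fc0 = trans (f-periodic c) (cong f (sym (+-identityʳ c)))

  sumBelow-periodic-blocks : ∀ q → sumBelow (q * d) f ≡ q * sumBelow d f
  sumBelow-periodic-blocks zero    = refl
  sumBelow-periodic-blocks (suc q) = begin
    sumBelow (d + q * d) f                                ≡⟨ sumBelow-split d (q * d) f ⟩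
    sumBelow d f + sumBelow (q * d) (λ j → f (d + j))     ≡⟨ cong (sumBelow d f +_) shifted ⟩
    sumBelow d f + q * sumBelow d f                       ∎
    where
    open ≡-Reasoning
    shifted : sumBelow (q * d) (λ j → f (d + j)) ≡ q * sumBelow d f
    shifted = trans (sumBelow-cong (q * d) (λ j _ → trans (cong f (+-comm d j)) (f-periodic j)))
                    (sumBelow-periodic-blocks q)

sumBelow-δ-≥ : ∀ {d t} → d ≤ t → sumBelow d (λ j → δ j t) ≡ 0
sumBelow-δ-≥ {zero}  _   = refl
sumBelow-δ-≥ {suc d} d<t = cong₂ _+_ (sumBelow-δ-≥ (<⇒≤ d<t)) (δ-≢ (<⇒≢ d<t))

sumBelow-δ-< : ∀ {d t} → t < d → sumBelow d (λ j → δ j t) ≡ 1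
sumBelow-δ-< {suc d} {t} t<1+d with t ≟ d
... | yes refl = cong₂ _+_ (sumBelow-δ-≥ {t} ≤-refl) (δ-refl t)
... | no  t≢d  = cong₂ _+_ (sumBelow-δ-< (≤∧≢⇒< (≤-pred t<1+d) t≢d)) (δ-≢ (t≢d ∘ sym))

sumBelow-δ-residue : ∀ c {t d k} .{{_ : NonZero d}} → t < d → d ∣ k →
                     sumBelow k (λ j → δ ((c + j) % d) t) ≡ k / d
sumBelow-δ-residue c {t} {d} t<d (divides q refl) = begin
  sumBelow (q * d) (λ j → f (c + j))   ≡⟨ sumBelow-periodic-blocks (λ j → f (c + j)) shifted-periodic q ⟩
  q * sumBelow d (λ j → f (c + j))     ≡⟨ cong (q *_) (sumBelow-periodic-shift f f-periodic c) ⟩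
  q * sumBelow d f                     ≡⟨ cong (q *_) (sumBelow-cong d (λ j j<d → cong (λ x → δ x t) (m<n⇒m%n≡m j<d))) ⟩
  q * sumBelow d (λ j → δ j t)         ≡⟨ cong (q *_) (sumBelow-δ-< t<d) ⟩
  q * 1                                ≡⟨ *-identityʳ q ⟩
  q                                    ≡⟨ m*n/n≡m q d ⟨
  q * d / d                            ∎
  where
  open ≡-Reasoning
  f : ℕ → ℕ
  f x = δ (x % d) t
  f-periodic : ∀ x → f (x + d) ≡ f x
  f-periodic x = cong (λ y → δ y t) ([m+n]%n≡m%n x d)
  shifted-periodic : ∀ x → f (c + (x + d)) ≡ f (c + x)
  shifted-periodic x = trans (cong f (sym (+-assoc c x d))) (f-periodic (c + x))

+-/-1/-cross-multiplied : ∀ s k d q → k ≡ q * d →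
  (ℤ.+ s ℤ.* ℤ.+ d ℤ.+ ℤ.+ 1 ℤ.* ℤ.+ k) ℤ.* ℤ.+ k ≡ ℤ.+ (s + q) ℤ.* (ℤ.+ k ℤ.* ℤ.+ d)
+-/-1/-cross-multiplied s k d q k≡q*d = begin
  (ℤ.+ s ℤ.* ℤ.+ d ℤ.+ ℤ.+ 1 ℤ.* ℤ.+ k) ℤ.* ℤ.+ k   ≡⟨ cong (ℤ._* ℤ.+ k) (cong₂ ℤ._+_ (pos-* s d) (pos-* 1 k)) ⟨
  (ℤ.+ (s * d) ℤ.+ ℤ.+ (1 * k)) ℤ.* ℤ.+ k           ≡⟨ cong (ℤ._* ℤ.+ k) (pos-+ (s * d) (1 * k)) ⟨
  ℤ.+ (s * d + 1 * k) ℤ.* ℤ.+ k                      ≡⟨ pos-* (s * d + 1 * k) k ⟨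
  ℤ.+ ((s * d + 1 * k) * k)                          ≡⟨ cong ℤ.+_ (in-ℕ k≡q*d) ⟩
  ℤ.+ ((s + q) * (k * d))                            ≡⟨ pos-* (s + q) (k * d) ⟩
  ℤ.+ (s + q) ℤ.* ℤ.+ (k * d)                        ≡⟨ cong (ℤ.+ (s + q) ℤ.*_) (pos-* k d) ⟩
  ℤ.+ (s + q) ℤ.* (ℤ.+ k ℤ.* ℤ.+ d)                  ∎
  where
  open ≡-Reasoning
  semiring-identity : ∀ s q d → (s * d + 1 * (q * d)) * (q * d) ≡ (s + q) * ((q * d) * d)
  semiring-identity = solve-∀
  in-ℕ : ∀ {k} → k ≡ q * d → (s * d + 1 * k) * k ≡ (s + q) * (k * d)
  in-ℕ refl = semiring-identity s q d

+-/-1/ : ∀ s k d q .{{_ : NonZero k}} .{{_ : NonZero d}} → k ≡ q * d →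
         ℤ.+ s ℚ./ k ℚ.+ ℤ.+ 1 ℚ./ d ≡ ℤ.+ (s + q) ℚ./ k
+-/-1/ s k@(suc k-1) d@(suc d-1) q k≡q*d = toℚᵘ-injective (begin
  ℚ.toℚᵘ (ℤ.+ s ℚ./ k ℚ.+ ℤ.+ 1 ℚ./ d)                 ≈⟨ toℚᵘ-homo-+ (ℤ.+ s ℚ./ k) (ℤ.+ 1 ℚ./ d) ⟩
  ℚ.toℚᵘ (ℤ.+ s ℚ./ k) ℚᵘ.+ ℚ.toℚᵘ (ℤ.+ 1 ℚ./ d)       ≈⟨ +-cong (toℚᵘ-fromℚᵘ (mkℚᵘ (ℤ.+ s) k-1)) (toℚᵘ-fromℚᵘ (mkℚᵘ (ℤ.+ 1) d-1)) ⟩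
  mkℚᵘ (ℤ.+ s) k-1 ℚᵘ.+ mkℚᵘ (ℤ.+ 1) d-1               ≈⟨ *≡* (+-/-1/-cross-multiplied s k d q k≡q*d) ⟩
  mkℚᵘ (ℤ.+ (s + q)) k-1                               ≈⟨ ≃-sym (toℚᵘ-fromℚᵘ (mkℚᵘ (ℤ.+ (s + q)) k-1)) ⟩
  ℚ.toℚᵘ (ℤ.+ (s + q) ℚ./ k)                           ∎)
  where open ≃-Reasoning

harmonic-sumBelow : ∀ n k .{{_ : NonZero k}} → (∀ m → m < n → suc m ∣ k) →
                    ℤ.+ sumBelow n (λ m → k / suc m) ℚ./ k ≡ harmonic n
harmonic-sumBelow zero    k _          = 0/n≡0 k
harmonic-sumBelow (suc n) k [1+m]∣k = begin
  ℤ.+ (sumBelow n (λ m → k / suc m) + k / suc n) ℚ./ k            ≡⟨ +-/-1/ (sumBelow n (λ m → k / suc m)) k (suc n) (k / suc n) (sym (m/n*n≡m ([1+m]∣k n (n<1+n n)))) ⟨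
  ℤ.+ sumBelow n (λ m → k / suc m) ℚ./ k ℚ.+ ℤ.+ 1 ℚ./ suc n      ≡⟨ cong (ℚ._+ ℤ.+ 1 ℚ./ suc n) (harmonic-sumBelow n k (λ m m<n → [1+m]∣k m (m<n⇒m<1+n m<n))) ⟩
  harmonic n ℚ.+ ℤ.+ 1 ℚ./ suc n                                   ∎
  where open ≡-Reasoning

hits : (ℕ → ℕ) → List ℕ → ℕ
hits t []       = 0
hits t (c ∷ cs) = δ c (t (length cs)) + hits t cs

length-lehmer : ∀ xs → length (lehmer xs) ≡ length xs
length-lehmer []       = refl
length-lehmer (_ ∷ xs) = cong suc (length-lehmer xs)

rlMax≡hits-lehmer : ∀ σ → rlMax σ ≡ hits (λ m → m) (lehmer σ)
rlMax≡hits-lehmer []       = refl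
rlMax≡hits-lehmer (x ∷ xs) with all? (_<? x) xs
... | yes all<x rewrite filter-all (_<? x) all<x | length-lehmer xs | δ-refl (length xs) =
  cong suc (rlMax≡hits-lehmer xs)
... | no ¬all<x rewrite length-lehmer xs
                      | δ-≢ (<⇒≢ (filter-notAll (_<? x) xs (¬All⇒Any¬ (_<? x) xs ¬all<x))) =
  rlMax≡hits-lehmer xs

some-below : ∀ {x xs} → All (x ≢_) xs → Any (λ y → ¬ x < y) xs → Any (_< x) xs
some-below (x≢y ∷ _)   (here x≮y)  = here (≤∧≢⇒< (≮⇒≥ x≮y) (x≢y ∘ sym))
some-below (_ ∷ x≢ys) (there any) = there (some-below x≢ys any)

rlMin≡hits-lehmer : ∀ σ → Unique σ → rlMin σ ≡ hits (λ _ → 0) (lehmer σ)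
rlMin≡hits-lehmer []       _ = refl
rlMin≡hits-lehmer (x ∷ xs) (x∉xs ∷ uniq) with all? (x <?_) xs
... | yes x<all rewrite filter-none (_<? x) (All.map <⇒≯ x<all) = cong suc (rlMin≡hits-lehmer xs uniq)
... | no ¬x<all rewrite δ-≢ ((<⇒≢ (filter-some (_<? x) (some-below x∉xs (¬All⇒Any¬ (x <?_) xs ¬x<all)))) ∘ sym) =
  rlMin≡hits-lehmer xs uniq

IsCode : List ℕ → Set
IsCode []       = ⊤
IsCode (c ∷ cs) = c < suc (length cs) × IsCode cs

lehmer-isCode : ∀ σ → IsCode (lehmer σ)
lehmer-isCode []       = tt
lehmer-isCode (x ∷ xs) rewrite length-lehmer xs = s≤s (length-filter (_<? x) xs) , lehmer-isCode xs

length-rotCode : ∀ cs → length (rotCode cs) ≡ length cs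
length-rotCode []       = refl
length-rotCode (c ∷ cs) = cong suc (length-rotCode cs)

length-iter-rotCode : ∀ j cs → length (iter rotCode j cs) ≡ length cs
length-iter-rotCode zero    cs = refl
length-iter-rotCode (suc j) cs = trans (length-rotCode (iter rotCode j cs)) (length-iter-rotCode j cs)

iter-rotCode-[] : ∀ j → iter rotCode j [] ≡ []
iter-rotCode-[] zero    = refl
iter-rotCode-[] (suc j) = cong rotCode (iter-rotCode-[] j)

[1+m%n]%n≡[1+m]%n : ∀ m n .{{_ : NonZero n}} → suc (m % n) % n ≡ suc m % n
[1+m%n]%n≡[1+m]%n m n = begin
  (1 + m % n) % n              ≡⟨ %-distribˡ-+ 1 (m % n) n ⟩
  (1 % n + m % n % n) % n      ≡⟨ cong (λ r → (1 % n + r) % n) (m%n%n≡m%n m n) ⟩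
  (1 % n + m % n) % n          ≡⟨ %-distribˡ-+ 1 m n ⟨
  (1 + m) % n                  ∎
  where open ≡-Reasoning

iter-rotCode-∷ : ∀ j c cs → c < suc (length cs) →
                 iter rotCode j (c ∷ cs) ≡ ((c + j) % suc (length cs)) ∷ iter rotCode j cs
iter-rotCode-∷ zero    c cs c<d = cong (_∷ cs) (sym (trans (cong (_% suc (length cs)) (+-identityʳ c)) (m<n⇒m%n≡m c<d)))
iter-rotCode-∷ (suc j) c cs c<d rewrite iter-rotCode-∷ j c cs c<d | length-iter-rotCode j cs | +-suc c j =
  cong (_∷ rotCode (iter rotCode j cs)) ([1+m%n]%n≡[1+m]%n (c + j) (suc (length cs)))

[m+n]%d≡m⇒d∣n : ∀ m n d .{{_ : NonZero d}} → (m + n) % d ≡ m → d ∣ n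
[m+n]%d≡m⇒d∣n m n d [m+n]%d≡m = divides ((m + n) / d) (+-cancelˡ-≡ m _ _ (begin
  m + n                          ≡⟨ m≡m%n+[m/n]*n (m + n) d ⟩
  (m + n) % d + (m + n) / d * d  ≡⟨ cong (_+ (m + n) / d * d) [m+n]%d≡m ⟩
  m + (m + n) / d * d            ∎))
  where open ≡-Reasoning

-- The entry followed by m entries is rotated modulo m + 1, so a period of the whole code is a
-- multiple of every m + 1.
iter-rotCode-period : ∀ k cs → IsCode cs → iter rotCode k cs ≡ cs → ∀ m → m < length cs → suc m ∣ k
iter-rotCode-period k (c ∷ cs) (c<d , isCode) period m m<1+len
  with ∷-injective (trans (sym (iter-rotCode-∷ k c cs c<d)) period) | m ≟ length cs
... | head-fixed , _         | yes refl = [m+n]%d≡m⇒d∣n c k (suc (length cs)) head-fixed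
... | _          , tail-fixed | no  m≢len =
  iter-rotCode-period k cs isCode tail-fixed m (≤∧≢⇒< (≤-pred m<1+len) m≢len)

sumBelow-hits-orbit : ∀ (t : ℕ → ℕ) → (∀ m → t m < suc m) → ∀ k cs → IsCode cs →
                      (∀ m → m < length cs → suc m ∣ k) →
                      sumBelow k (λ j → hits t (iter rotCode j cs)) ≡ sumBelow (length cs) (λ m → k / suc m)
sumBelow-hits-orbit t _ k [] _ _ =
  trans (sumBelow-cong k (λ j _ → cong (hits t) (iter-rotCode-[] j))) (sumBelow-zero k)
sumBelow-hits-orbit t t-bounded k (c ∷ cs) (c<d , isCode) [1+m]∣k = begin
  sumBelow k (λ j → hits t (iter rotCode j (c ∷ cs)))                 ≡⟨ sumBelow-cong k (λ j _ → unfold j) ⟩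
  sumBelow k (λ j → δ ((c + j) % d) (t ℓ) + hits t (iter rotCode j cs)) ≡⟨ sumBelow-+ k _ _ ⟩
  sumBelow k (λ j → δ ((c + j) % d) (t ℓ)) + sumBelow k (λ j → hits t (iter rotCode j cs))
    ≡⟨ cong₂ _+_ (sumBelow-δ-residue c (t-bounded ℓ) ([1+m]∣k ℓ (n<1+n ℓ)))
                 (sumBelow-hits-orbit t t-bounded k cs isCode (λ m m<ℓ → [1+m]∣k m (m<n⇒m<1+n m<ℓ))) ⟩
  k / d + sumBelow ℓ (λ m → k / suc m)                                 ≡⟨ +-comm (k / d) _ ⟩
  sumBelow ℓ (λ m → k / suc m) + k / d                                 ∎
  where
  open ≡-Reasoning
  ℓ = length cs
  d = suc ℓ
  unfold : ∀ j → hits t (iter rotCode j (c ∷ cs)) ≡ δ ((c + j) % d) (t ℓ) + hits t (iter rotCode j cs)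
  unfold j rewrite iter-rotCode-∷ j c cs c<d | length-iter-rotCode j cs = refl

unique-perm : ∀ {n σ} → IsPerm n σ → Unique σ
unique-perm {n} σ↭upTo = Unique-resp-↭ (setoid ℕ) (↭⇒↭ₛ (↭-sym σ↭upTo)) (upTo⁺ n)

length-lehmer-perm : ∀ {n σ} → IsPerm n σ → length (lehmer σ) ≡ n
length-lehmer-perm {n} {σ} σ↭upTo = trans (length-lehmer σ) (trans (↭-length σ↭upTo) (length-upTo n))

module _ {n : ℕ} {X : List ℕ → List ℕ} (isRotation : IsLehmerRotation n X) where

  lehmer-iter : ∀ {σ} → IsPerm n σ → ∀ j → IsPerm n (iter X j σ) × lehmer (iter X j σ) ≡ iter rotCode j (lehmer σ)
  lehmer-iter σ-perm zero    = σ-perm , refl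
  lehmer-iter σ-perm (suc j) with lehmer-iter σ-perm j
  ... | τ-perm , lehmer-τ = proj₁ (isRotation _ τ-perm) , trans (proj₂ (isRotation _ τ-perm)) (cong rotCode lehmer-τ)

  hits-mesic : ∀ (f : List ℕ → ℕ) (t : ℕ → ℕ) → (∀ m → t m < suc m) →
               (∀ τ → IsPerm n τ → f τ ≡ hits t (lehmer τ)) → Mesic n X f (harmonic n)
  hits-mesic f t t-bounded f≡hits σ σ-perm k period _ = begin
    ℤ.+ sumBelow k (λ j → f (iter X j σ)) ℚ./ k
      ≡⟨ cong (λ s → ℤ.+ s ℚ./ k) (sumBelow-cong k (λ j _ → f-orbit j)) ⟩
    ℤ.+ sumBelow k (λ j → hits t (iter rotCode j (lehmer σ))) ℚ./ k
      ≡⟨ cong (λ s → ℤ.+ s ℚ./ k) (sumBelow-hits-orbit t t-bounded k (lehmer σ) (lehmer-isCode σ) [1+m]∣k) ⟩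
    ℤ.+ sumBelow (length (lehmer σ)) (λ m → k / suc m) ℚ./ k
      ≡⟨ harmonic-sumBelow (length (lehmer σ)) k [1+m]∣k ⟩
    harmonic (length (lehmer σ))
      ≡⟨ cong harmonic (length-lehmer-perm σ-perm) ⟩
    harmonic n ∎
    where
    open ≡-Reasoning
    f-orbit : ∀ j → f (iter X j σ) ≡ hits t (iter rotCode j (lehmer σ))
    f-orbit j = trans (f≡hits _ (proj₁ (lehmer-iter σ-perm j))) (cong (hits t) (proj₂ (lehmer-iter σ-perm j)))
    [1+m]∣k : ∀ m → m < length (lehmer σ) → suc m ∣ k
    [1+m]∣k = iter-rotCode-period k (lehmer σ) (lehmer-isCode σ)
                (trans (sym (proj₂ (lehmer-iter σ-perm k))) (cong lehmer period))

proposition4p38 : (n : ℕ) → .{{_ : Data.Nat.NonZero n}} → (X : List ℕ → List ℕ) → IsLehmerRotation n X →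
    Mesic n X rlMax (harmonic n) × Mesic n X rlMin (harmonic n)
proposition4p38 n X isRotation =
  hits-mesic isRotation rlMax (λ m → m) n<1+n (λ τ _ → rlMax≡hits-lehmer τ) ,
  hits-mesic isRotation rlMin (λ _ → 0) (λ _ → z<s) (λ τ τ-perm → rlMin≡hits-lehmer τ (unique-perm τ-perm))
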